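{- There are continuum many pairwise incomparable (with respect to inclusion) modal clones with respect to $\mathbf{K}$. Consequently, not every modal clone with respect to $\mathbf{K}$ is finitely generated.
   Context: $\mathbf{K}$ is the minimal normal modal logic. For a normal modal logic $\Lambda$, the Lindenbaum–Tarski algebra $\mathcal{A}_\Lambda$ has as universe the $\Lambda$-provable-equivalence classes $[\phi]_\Lambda$ of modal formulas (built from propositional variables with $\neg,\land,\lor,\Diamond,\Box$), with operations $\land,\lor,\neg,\top,\bot,\Diamond$ induced by the connectives. A clone on a set $A$ is a set of finitary operations $A^n\to A$ ($n\ge1$) containing all projections and closed under composition; the clone generated by an algebra is the smallest clone containing its operations (constants treated as constant unary operations). A modal clone with respect to $\Lambda$ is any subclone of the clone generated by $\mathcal{A}_\Lambda$. A clone is finitely generated if it is the smallest clone containing some finite set of operations. -}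

module Defs where

open import Data.Nat using (ℕ; suc)
open import Data.Fin using (Fin; zero; suc)
open import Data.Bool using (Bool; true; false; not; _∧_; _∨_)
open import Data.Product using (Σ; _×_; _,_)
open import Relation.Binary.PropositionalEquality using (_≡_)
open import Relation.Nullary using (¬_)

infixr 6 _∧'_
infixr 5 _∨'_
infixr 4 _⇒_ _⇔_

data Form : Set where
  var      : ℕ → Form
  ⊤' ⊥'    : Form
  ¬'_      : Form → Form
  _∧'_ _∨'_ : Form → Form → Form
  ◇ □      : Form → Form

_⇒_ : Form → Form → Form
φ ⇒ ψ = (¬' φ) ∨' ψ

_⇔_ : Form → Form → Form
φ ⇔ ψ = (φ ⇒ ψ) ∧' (ψ ⇒ φ)

eval : (Form → Bool) → Form → Bool
eval v (var n)   = v (var n)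
eval v ⊤'        = true
eval v ⊥'        = false
eval v (¬' φ)    = not (eval v φ)
eval v (φ ∧' ψ)  = eval v φ ∧ eval v ψ
eval v (φ ∨' ψ)  = eval v φ ∨ eval v ψ
eval v (◇ φ)     = v (◇ φ)
eval v (□ φ)     = v (□ φ)

-- φ is (an instance of) a propositional tautology
Taut : Form → Set
Taut φ = ∀ (v : Form → Bool) → eval v φ ≡ true

infix 2 ⊢K_
data ⊢K_ : Form → Set where
  taut : ∀ {φ} → Taut φ → ⊢K φ
  axK  : ∀ {φ ψ} → ⊢K □ (φ ⇒ ψ) ⇒ (□ φ ⇒ □ ψ)
  dual : ∀ {φ} → ⊢K ◇ φ ⇔ ¬' □ (¬' φ)
  mp   : ∀ {φ ψ} → ⊢K φ ⇒ ψ → ⊢K φ → ⊢K ψ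
  nec  : ∀ {φ} → ⊢K φ → ⊢K □ φ

-- K-provable equivalence: the equality of the Lindenbaum–Tarski algebra A_K
infix 3 _~_
_~_ : Form → Form → Set
φ ~ ψ = ⊢K φ ⇔ ψ

-- Operations on A_K (represented on representatives)

Op : ℕ → Set
Op k = (Fin k → Form) → Form

Congruent : ∀ {k} → Op k → Set
Congruent {k} f = ∀ (xs ys : Fin k → Form) → (∀ i → xs i ~ ys i) → f xs ~ f ys

infix 3 _≈_
_≈_ : ∀ {k} → Op k → Op k → Set
f ≈ g = ∀ xs → f xs ~ g xs

proj : ∀ {k} → Fin k → Op k
proj i xs = xs i

compose : ∀ {m k} → Op m → (Fin m → Op k) → Op k
compose f gs xs = f (λ i → gs i xs)

OpSet : Set₁
OpSet = ∀ {n} → Op (suc n) → Set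

_⊆_ : OpSet → OpSet → Set
C ⊆ D = ∀ {n} (f : Op (suc n)) → C f → D f

record IsClone (C : OpSet) : Set where
  field
    well-defined : ∀ {n} (f : Op (suc n)) → C f → Congruent f
    resp-≈       : ∀ {n} (f g : Op (suc n)) → f ≈ g → C f → C g
    projections  : ∀ {n} (i : Fin (suc n)) → C (proj i)
    composition  : ∀ {m n} (f : Op (suc m)) (gs : Fin (suc m) → Op (suc n)) →
                   C f → (∀ i → C (gs i)) → C (compose f gs)

data Gen (F : OpSet) : OpSet where
  base  : ∀ {n} {f : Op (suc n)} → F f → Gen F f
  prj   : ∀ {n} (i : Fin (suc n)) → Gen F (proj i)
  comp  : ∀ {m n} {f : Op (suc m)} {gs : Fin (suc m) → Op (suc n)} →
          Gen F f → (∀ i → Gen F (gs i)) → Gen F (compose f gs)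
  resp  : ∀ {n} {f g : Op (suc n)} → f ≈ g → Gen F f → Gen F g

-- Basic operations of A_K : ∧, ∨, ¬, ⊤, ⊥ (constants as constant unary
-- operations) and ◇.
data BasicOp : OpSet where
  op∧ : BasicOp {1} (λ xs → xs zero ∧' xs (suc zero))
  op∨ : BasicOp {1} (λ xs → xs zero ∨' xs (suc zero))
  op¬ : BasicOp {0} (λ xs → ¬' xs zero)
  op⊤ : BasicOp {0} (λ xs → ⊤')
  op⊥ : BasicOp {0} (λ xs → ⊥')
  op◇ : BasicOp {0} (λ xs → ◇ (xs zero))

CloneK : OpSet
CloneK = Gen BasicOp

ModalClone : OpSet → Set
ModalClone C = IsClone C × (C ⊆ CloneK)

data Member {m : ℕ} (ar : Fin m → ℕ) (gs : (i : Fin m) → Op (suc (ar i))) : OpSet where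
  mem : (i : Fin m) → Member ar gs (gs i)

FinitelyGenerated : OpSet → Set
FinitelyGenerated C =
  Σ ℕ λ m → Σ (Fin m → ℕ) λ ar → Σ ((i : Fin m) → Op (suc (ar i))) λ gs →
    (C ⊆ Gen (Member ar gs)) × (Gen (Member ar gs) ⊆ C)

Apart : (ℕ → Bool) → (ℕ → Bool) → Set
Apart s t = Σ ℕ λ n → ¬ (s n ≡ t n)

-- The constants ◇ᵃ⊤ (a ∈ ℕ) are pairwise K-inequivalent: on the Kripke frame ℕ in which
-- w + 1 sees only w, ◇ᵃ⊤ holds exactly at the worlds ≥ a. Hence for every Q ⊆ ℕ the
-- projections together with the constant operations ◇ᵃ⊤, a ∈ Q, form a modal clone which
-- contains the constant ◇ᵃ⊤ only when a ∈ Q. Coding each binary sequence s by the set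
-- {2k + [s k = true] | k ∈ ℕ} gives continuum many incomparable clones. Taking Q = ℕ gives a
-- clone that is not finitely generated: finitely many generators only reach the constants
-- ◇ᵃ⊤ below the largest exponent among them.
module Submission where

open import Defs
open import Data.Nat using (ℕ; zero; suc; _≤_; _<_; _⊔_)
open import Data.Nat.Properties using (suc-injective; ≤-refl; ≤-trans; m≤m⊔n; m≤n⊔m; <⇒≱)
open import Data.Bool using (Bool; true; false; not; _∧_; _∨_)
open import Data.Bool.Properties using (not-involutive)
open import Data.Fin using (Fin; zero; suc)
open import Data.Product using (Σ; _×_; _,_; proj₁; proj₂)
open import Data.Unit using (⊤; tt)
open import Data.Empty using (⊥-elim)
open import Function using (_∘_; const)
open import Relation.Nullary using (¬_)
open import Relation.Binary.PropositionalEquality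
  using (_≡_; refl; sym; trans; cong; cong₂; subst)

infixr 4 _⇒ᵇ_ _⇔ᵇ_

_⇒ᵇ_ : Bool → Bool → Bool
a ⇒ᵇ b = not a ∨ b

_⇔ᵇ_ : Bool → Bool → Bool
a ⇔ᵇ b = (a ⇒ᵇ b) ∧ (b ⇒ᵇ a)

⇒ᵇ-refl : ∀ a → (a ⇒ᵇ a) ≡ true
⇒ᵇ-refl true  = refl
⇒ᵇ-refl false = refl

⇒ᵇ-mp : ∀ a b → (a ⇒ᵇ b) ≡ true → a ≡ true → b ≡ true
⇒ᵇ-mp true b a⇒b refl = a⇒b

⇔ᵇ-refl : ∀ a → (a ⇔ᵇ a) ≡ true
⇔ᵇ-refl true  = refl
⇔ᵇ-refl false = refl

⇔ᵇ-sym : ∀ a b → ((a ⇔ᵇ b) ⇒ᵇ (b ⇔ᵇ a)) ≡ true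
⇔ᵇ-sym true  true  = refl
⇔ᵇ-sym true  false = refl
⇔ᵇ-sym false true  = refl
⇔ᵇ-sym false false = refl

⇔ᵇ-trans : ∀ a b c → ((a ⇔ᵇ b) ⇒ᵇ (b ⇔ᵇ c) ⇒ᵇ (a ⇔ᵇ c)) ≡ true
⇔ᵇ-trans true  true  true  = refl
⇔ᵇ-trans true  true  false = refl
⇔ᵇ-trans true  false c     = refl
⇔ᵇ-trans false true  c     = refl
⇔ᵇ-trans false false true  = refl
⇔ᵇ-trans false false false = refl

⇔ᵇ-true⇒≡ : ∀ a b → (a ⇔ᵇ b) ≡ true → a ≡ b
⇔ᵇ-true⇒≡ true  true  _ = refl
⇔ᵇ-true⇒≡ false false _ = refl
⇔ᵇ-true⇒≡ true  false ()
⇔ᵇ-true⇒≡ false true  ()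

~-refl : ∀ {φ} → φ ~ φ
~-refl {φ} = taut (λ v → ⇔ᵇ-refl (eval v φ))

~-sym : ∀ {φ ψ} → φ ~ ψ → ψ ~ φ
~-sym {φ} {ψ} = mp (taut (λ v → ⇔ᵇ-sym (eval v φ) (eval v ψ)))

~-trans : ∀ {φ ψ χ} → φ ~ ψ → ψ ~ χ → φ ~ χ
~-trans {φ} {ψ} {χ} φ~ψ = mp (mp (taut (λ v → ⇔ᵇ-trans (eval v φ) (eval v ψ) (eval v χ))) φ~ψ)

-- Satisfaction in the Kripke model on ℕ where w + 1 sees w and 0 is a dead end;
-- V w n is the truth value of var n at w.
sat : (ℕ → ℕ → Bool) → ℕ → Form → Bool
sat V w       (var n)  = V w n
sat V w       ⊤'       = true
sat V w       ⊥'       = false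
sat V w       (¬' φ)   = not (sat V w φ)
sat V w       (φ ∧' ψ) = sat V w φ ∧ sat V w ψ
sat V w       (φ ∨' ψ) = sat V w φ ∨ sat V w ψ
sat V zero    (◇ φ)    = false
sat V (suc w) (◇ φ)    = sat V w φ
sat V zero    (□ φ)    = true
sat V (suc w) (□ φ)    = sat V w φ

eval-sat : ∀ V w φ → eval (sat V w) φ ≡ sat V w φ
eval-sat V w (var n)  = refl
eval-sat V w ⊤'       = refl
eval-sat V w ⊥'       = refl
eval-sat V w (¬' φ)   = cong not (eval-sat V w φ)
eval-sat V w (φ ∧' ψ) = cong₂ _∧_ (eval-sat V w φ) (eval-sat V w ψ)
eval-sat V w (φ ∨' ψ) = cong₂ _∨_ (eval-sat V w φ) (eval-sat V w ψ)
eval-sat V w (◇ φ)    = refl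
eval-sat V w (□ φ)    = refl

⊢K-sound : ∀ {φ} → ⊢K φ → ∀ V w → sat V w φ ≡ true
⊢K-sound {φ} (taut t)           V w       = trans (sym (eval-sat V w φ)) (t (sat V w))
⊢K-sound axK                    V zero    = refl
⊢K-sound (axK {φ} {ψ})          V (suc w) = ⇒ᵇ-refl (sat V w φ ⇒ᵇ sat V w ψ)
⊢K-sound dual                   V zero    = refl
⊢K-sound (dual {φ})             V (suc w) =
  subst (λ b → (sat V w φ ⇔ᵇ b) ≡ true) (sym (not-involutive _)) (⇔ᵇ-refl (sat V w φ))
⊢K-sound (mp {φ} {ψ} ⊢φ⇒ψ ⊢φ)    V w       =
  ⇒ᵇ-mp (sat V w φ) (sat V w ψ) (⊢K-sound ⊢φ⇒ψ V w) (⊢K-sound ⊢φ V w)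
⊢K-sound (nec ⊢φ)               V zero    = refl
⊢K-sound (nec ⊢φ)               V (suc w) = ⊢K-sound ⊢φ V w

~⇒sat-≡ : ∀ {φ ψ} → φ ~ ψ → ∀ V w → sat V w φ ≡ sat V w ψ
~⇒sat-≡ {φ} {ψ} φ~ψ V w = ⇔ᵇ-true⇒≡ (sat V w φ) (sat V w ψ) (⊢K-sound φ~ψ V w)

◇ⁿ⊤ : ℕ → Form
◇ⁿ⊤ zero    = ⊤'
◇ⁿ⊤ (suc a) = ◇ (◇ⁿ⊤ a)

sat-◇ⁿ⊤-self : ∀ V a → sat V a (◇ⁿ⊤ a) ≡ true
sat-◇ⁿ⊤-self V zero    = refl
sat-◇ⁿ⊤-self V (suc a) = sat-◇ⁿ⊤-self V a

sat-◇ⁿ⊤-injective : ∀ {V} a b → (∀ w → sat V w (◇ⁿ⊤ a) ≡ sat V w (◇ⁿ⊤ b)) → a ≡ b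
sat-◇ⁿ⊤-injective zero    zero    _    = refl
sat-◇ⁿ⊤-injective zero    (suc b) same with same zero
... | ()
sat-◇ⁿ⊤-injective (suc a) zero    same with same zero
... | ()
sat-◇ⁿ⊤-injective (suc a) (suc b) same = cong suc (sat-◇ⁿ⊤-injective a b (same ∘ suc))

V₀ : ℕ → ℕ → Bool
V₀ _ _ = false

◇ⁿ⊤-injective : ∀ {a b} → ◇ⁿ⊤ a ~ ◇ⁿ⊤ b → a ≡ b
◇ⁿ⊤-injective {a} {b} eq = sat-◇ⁿ⊤-injective {V₀} a b (~⇒sat-≡ eq V₀)

⊥≁◇ⁿ⊤ : ∀ a → ¬ (⊥' ~ ◇ⁿ⊤ a)
⊥≁◇ⁿ⊤ a eq with trans (~⇒sat-≡ eq V₀ a) (sat-◇ⁿ⊤-self V₀ a)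
... | ()

◇ⁿ⊤∈CloneK : ∀ {n} a → CloneK {n} (const (◇ⁿ⊤ a))
◇ⁿ⊤∈CloneK zero    = comp (base op⊤) (λ _ → prj zero)
◇ⁿ⊤∈CloneK (suc a) = comp (base op◇) (λ _ → ◇ⁿ⊤∈CloneK a)

Gen-minimal : ∀ {F C : OpSet} → IsClone C → F ⊆ C → Gen F ⊆ C
Gen-minimal C-clone F⊆C f (base f∈F) = F⊆C f f∈F
Gen-minimal C-clone F⊆C f (prj i)    = IsClone.projections C-clone i
Gen-minimal C-clone F⊆C f (comp {f = g} {gs = gs} g∈ gs∈) =
  IsClone.composition C-clone g gs (Gen-minimal C-clone F⊆C g g∈)
    (λ i → Gen-minimal C-clone F⊆C (gs i) (gs∈ i))
Gen-minimal C-clone F⊆C f (resp {f = g} g≈f g∈) =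
  IsClone.resp-≈ C-clone g f g≈f (Gen-minimal C-clone F⊆C g g∈)

data ConstantClone (Q : ℕ → Set) : OpSet where
  projection : ∀ {n} {f : Op (suc n)} (i : Fin (suc n)) → proj i ≈ f → ConstantClone Q f
  constant   : ∀ {n} {f : Op (suc n)} {a} → Q a → const (◇ⁿ⊤ a) ≈ f → ConstantClone Q f

ConstantClone-isClone : ∀ Q → IsClone (ConstantClone Q)
ConstantClone-isClone Q = record
  { well-defined = well-defined
  ; resp-≈       = resp-≈
  ; projections  = λ i → projection i (λ _ → ~-refl)
  ; composition  = composition
  }
  where
  well-defined : ∀ {n} (f : Op (suc n)) → ConstantClone Q f → Congruent f
  well-defined f (projection i eq) xs ys xs~ys = ~-trans (~-sym (eq xs)) (~-trans (xs~ys i) (eq ys))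
  well-defined f (constant _ eq)   xs ys _     = ~-trans (~-sym (eq xs)) (eq ys)

  resp-≈ : ∀ {n} (f g : Op (suc n)) → f ≈ g → ConstantClone Q f → ConstantClone Q g
  resp-≈ f g f≈g (projection i eq) = projection i (λ xs → ~-trans (eq xs) (f≈g xs))
  resp-≈ f g f≈g (constant q eq)   = constant q (λ xs → ~-trans (eq xs) (f≈g xs))

  composition : ∀ {m n} (f : Op (suc m)) (gs : Fin (suc m) → Op (suc n)) →
                ConstantClone Q f → (∀ i → ConstantClone Q (gs i)) →
                ConstantClone Q (compose f gs)
  composition f gs (constant q eq)   _   = constant q (λ xs → eq (λ i → gs i xs))
  composition f gs (projection j eq) gs∈ =
    resp-≈ (gs j) (compose f gs) (λ xs → eq (λ i → gs i xs)) (gs∈ j)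

ConstantClone⊆CloneK : ∀ Q → ConstantClone Q ⊆ CloneK
ConstantClone⊆CloneK Q f (projection i eq) = resp eq (prj i)
ConstantClone⊆CloneK Q f (constant {a = a} _ eq) = resp eq (◇ⁿ⊤∈CloneK a)

ConstantClone-modal : ∀ Q → ModalClone (ConstantClone Q)
ConstantClone-modal Q = ConstantClone-isClone Q , ConstantClone⊆CloneK Q

ConstantClone-mono : ∀ {P Q : ℕ → Set} → (∀ {a} → P a → Q a) → ConstantClone P ⊆ ConstantClone Q
ConstantClone-mono P⊆Q f (projection i eq) = projection i eq
ConstantClone-mono P⊆Q f (constant p eq)   = constant (P⊆Q p) eq

-- A projection is separated from the constant ◇ᵃ⊤ by the argument ⊥.
ConstantClone-reflects : ∀ {Q a} → ConstantClone Q {0} (const (◇ⁿ⊤ a)) → Q a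
ConstantClone-reflects {a = a} (projection i eq) = ⊥-elim (⊥≁◇ⁿ⊤ a (eq (const ⊥')))
ConstantClone-reflects {Q} (constant q eq) = subst Q (◇ⁿ⊤-injective (eq (const ⊥'))) q

ConstantClone-⊆-reflects : ∀ {P Q : ℕ → Set} →
  ConstantClone P ⊆ ConstantClone Q → ∀ {a} → P a → Q a
ConstantClone-⊆-reflects P⊆Q {a} p =
  ConstantClone-reflects (P⊆Q (const (◇ⁿ⊤ a)) (constant p (λ _ → ~-refl)))

ConstantClone-bounded : ∀ {Q n} {f : Op (suc n)} → ConstantClone Q f →
  Σ ℕ λ B → ConstantClone (_≤ B) f
ConstantClone-bounded (projection i eq)       = 0 , projection i eq
ConstantClone-bounded (constant {a = a} _ eq) = a , constant ≤-refl eq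

upper-bound : ∀ {m} (f : Fin m → ℕ) → Σ ℕ λ B → ∀ i → f i ≤ B
upper-bound {zero}  f = 0 , λ ()
upper-bound {suc m} f with upper-bound (f ∘ suc)
... | B , f∘suc≤B = f zero ⊔ B , λ where
  zero    → m≤m⊔n (f zero) B
  (suc i) → ≤-trans (f∘suc≤B i) (m≤n⊔m (f zero) B)

Unbounded : (ℕ → Set) → Set
Unbounded Q = ∀ B → Σ ℕ λ a → Q a × B < a

ConstantClone-notFinitelyGenerated : ∀ {Q} → Unbounded Q → ¬ FinitelyGenerated (ConstantClone Q)
ConstantClone-notFinitelyGenerated unbounded (_ , ar , gs , C⊆Gen , Gen⊆C) =
  let (a , Qa , B<a) = unbounded B in
  <⇒≱ B<a (ConstantClone-reflects (Gen⊆Bounded _ (C⊆Gen _ (constant Qa (λ _ → ~-refl)))))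
  where
  bounded : ∀ i → Σ ℕ λ Bᵢ → ConstantClone (_≤ Bᵢ) (gs i)
  bounded i = ConstantClone-bounded (Gen⊆C (gs i) (base (mem i)))

  B : ℕ
  B = proj₁ (upper-bound (proj₁ ∘ bounded))

  Bᵢ≤B : ∀ i → proj₁ (bounded i) ≤ B
  Bᵢ≤B = proj₂ (upper-bound (proj₁ ∘ bounded))

  Gen⊆Bounded : Gen (Member ar gs) ⊆ ConstantClone (_≤ B)
  Gen⊆Bounded = Gen-minimal (ConstantClone-isClone _) λ where
    _ (mem i) → ConstantClone-mono (λ a≤Bᵢ → ≤-trans a≤Bᵢ (Bᵢ≤B i)) (gs i) (proj₂ (bounded i))

code : ℕ → Bool → ℕ
code zero    false = 0
code zero    true  = 1
code (suc k) b     = suc (suc (code k b))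

code-injective : ∀ {k k′ b b′} → code k b ≡ code k′ b′ → k ≡ k′ × b ≡ b′
code-injective {zero}  {zero}   {false} {false} refl = refl , refl
code-injective {zero}  {zero}   {true}  {true}  refl = refl , refl
code-injective {zero}  {zero}   {false} {true}  ()
code-injective {zero}  {zero}   {true}  {false} ()
code-injective {zero}  {suc k′} {false} ()
code-injective {zero}  {suc k′} {true}  ()
code-injective {suc k} {zero}   {b′ = false} ()
code-injective {suc k} {zero}   {b′ = true}  ()
code-injective {suc k} {suc k′} eq with code-injective {k} {k′} (suc-injective (suc-injective eq))
... | refl , b≡b′ = refl , b≡b′

Code : (ℕ → Bool) → ℕ → Set
Code s a = Σ ℕ λ k → a ≡ code k (s k)

Code-apart : ∀ {s t} → Apart s t → ¬ (∀ {a} → Code s a → Code t a)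
Code-apart (n , sn≢tn) Code-s⊆Code-t with Code-s⊆Code-t (n , refl)
... | k , eq with code-injective {n} {k} eq
... | refl , sn≡tn = sn≢tn sn≡tn

fact4p6 : (Σ ((ℕ → Bool) → OpSet) λ F →
    ((s : ℕ → Bool) → ModalClone (F s))
    × ((s t : ℕ → Bool) → Apart s t → ¬ (F s ⊆ F t)))
    × ¬ ((C : OpSet) → ModalClone C → FinitelyGenerated C)
fact4p6 =
  ( (ConstantClone ∘ Code)
  , (ConstantClone-modal ∘ Code)
  , (λ s t s#t Fs⊆Ft → Code-apart s#t (ConstantClone-⊆-reflects Fs⊆Ft)) )
  , λ all-finitelyGenerated →
      ConstantClone-notFinitelyGenerated (λ B → suc B , tt , ≤-refl)
        (all-finitelyGenerated _ (ConstantClone-modal (const ⊤)))
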